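{- Let $k\ge3$, let $b$ be a natural number and let $\alpha<\varepsilon_0$ be such that there is no ordinal $\delta$ with $\alpha<\delta<\varepsilon_0$ and $A_\delta(k,b)\le A_\alpha(k,b)$. Then for every ordinal context $\lambda[[\cdot]]$, ordinal $\gamma$ and natural number $r$: if $\alpha=\lambda[[\omega^\gamma\cdot r]]$ and $\beta:=\lambda^*[[\omega^{\gamma+1}]]$, then $r\le A_{\beta_{k-1,k,A_\beta(k,b-1)}}(k,A_\beta(k,b-1))$.
   Context: Standard fundamental sequences for ordinals $<\varepsilon_0$: $0[x]:=0$, $(\alpha+1)[x]:=\alpha$; if $\alpha=\omega^{\alpha_1}+\dots+\omega^{\alpha_n}$ in Cantor normal form ($\alpha_1\ge\dots\ge\alpha_n$) with $\alpha_n$ a limit then $\alpha[x]:=\omega^{\alpha_1}+\dots+\omega^{\alpha_{n-1}}+\omega^{\alpha_n[x]}$, and if $\alpha_n=\beta+1$ then $\alpha[x]:=\omega^{\alpha_1}+\dots+\omega^{\alpha_{n-1}}+\omega^{\beta}\cdot x$. Extended Ackermann functions, for $\alpha<\varepsilon_0$ and $k,b<\omega$: $A_0(k,b):=b+1$; $A_{\alpha+1}(k,0):=A_\alpha(k,\cdot)^k(0)$; $A_{\alpha+1}(k,b+1):=A_\alpha(k,\cdot)^k(A_{\alpha+1}(k,b))$; for limit $\lambda$: $A_\lambda(k,0):=A_{\lambda_{k,k,0}}(k,\cdot)^k(0)$ and $A_\lambda(k,b+1):=A_{\lambda_{k,k,A_\lambda(k,b)}}(k,\cdot)^k(A_\lambda(k,b))$,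 where for an ordinal $\delta$ and natural $c$: $\delta_{0,k,c}:=\delta[c]$ and $\delta_{l+1,k,c}:=\delta[A_{\delta_{l,k,c}}(k,c)]$; upper index $k$ means $k$-fold iteration. By convention $A_\alpha(k,-1):=0$. An ordinal context $\lambda[[\cdot]]$ is a Cantor-normal-form expression for an ordinal below $\varepsilon_0$ with exactly one occurrence of a placeholder $[[\cdot]]$, of one of the forms: $[[\cdot]]$; $\omega^{\alpha_1}+\dots+\omega^{\alpha_i}+[[\cdot]]+\omega^{\alpha_{i+1}}+\dots+\omega^{\alpha_n}$; or $\omega^{\alpha_1}+\dots+\omega^{\alpha_{i-1}}+\omega^{\mu[[\cdot]]}+\omega^{\alpha_{i+1}}+\dots+\omega^{\alpha_n}$ with $\mu[[\cdot]]$ again a context. $\lambda[[\xi]]$ denotes substitution of $\xi$ for the placeholder. The truncation $\lambda^*$ cuts off hereditarily all terms after the placeholder: $[[\cdot]]^*:=[[\cdot]]$; for the second form $\lambda^*[[\cdot]]:=\omega^{\alpha_1}+\dots+\omega^{\alpha_i}+[[\cdot]]$; for the third form $\lambda^*[[\cdot]]:=\omega^{\alpha_1}+\dots+\omega^{\alpha_{i-1}}+\omega^{\mu^*[[\cdot]]}$. -}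

module Defs where

open import Data.Nat using (ℕ; zero; suc)
open import Data.Bool using (Bool; true; false; if_then_else_)
open import Data.Unit using (⊤)
open import Data.Empty using (⊥)
open import Data.Product using (_×_)
open import Relation.Binary.PropositionalEquality using (_≡_; _≢_)
open import Relation.Nullary using (¬_)

-- Ordinal notations (Cantor normal form terms).
-- `oz` is 0 and `ω^ a + c` is the term ω^a + c.  A term is read as the
-- list of its exponents ω^a₁ + ω^a₂ + … + ω^aₙ.

infixr 5 ω^_+_

data Ord : Set where
  oz    : Ord
  ω^_+_ : Ord → Ord → Ord

data Cmp : Set where
  lt eq gt : Cmp

-- lexicographic comparison; it is the ordinal order on normal forms
cmp : Ord → Ord → Cmp
cmp oz oz = eq
cmp oz (ω^ _ + _) = lt
cmp (ω^ _ + _) oz = gt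
cmp (ω^ a + c) (ω^ b + d) with cmp a b
... | lt = lt
... | gt = gt
... | eq = cmp c d

_<ₒ_ : Ord → Ord → Set
a <ₒ b = cmp a b ≡ lt

LeadOK : Ord → Ord → Set
LeadOK a oz = ⊤
LeadOK a (ω^ b + _) = ¬ (a <ₒ b)

-- Cantor normal form (hereditarily); these are exactly the ordinals < ε₀
data NF : Ord → Set where
  nf-z : NF oz
  nf-s : ∀ {a c} → NF a → NF c → LeadOK a c → NF (ω^ a + c)

osuc : Ord → Ord
osuc oz = ω^ oz + oz
osuc (ω^ a + c) = ω^ a + osuc c

rep : Ord → ℕ → Ord
rep b zero = oz
rep b (suc x) = ω^ b + rep b x

isSucc : Ord → Bool
isSucc oz = false
isSucc (ω^ oz + oz) = true
isSucc (ω^ (ω^ _ + _) + oz) = false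
isSucc (ω^ _ + (ω^ b + d)) = isSucc (ω^ b + d)

pred : Ord → Ord
pred oz = oz
pred (ω^ _ + oz) = oz
pred (ω^ a + (ω^ b + d)) = ω^ a + pred (ω^ b + d)

Limit : Ord → Set
Limit α = (α ≢ oz) × (isSucc α ≡ false)

infixl 20 _[_]
_[_] : Ord → ℕ → Ord
oz [ x ] = oz
(ω^ a + (ω^ b + d)) [ x ] = ω^ a + ((ω^ b + d) [ x ])
(ω^ oz + oz) [ x ] = oz
(ω^ (e@(ω^ _ + _)) + oz) [ x ] =
  if isSucc e then rep (pred e) x else (ω^ (e [ x ]) + oz)

-- Normalisation of a term to Cantor normal form (ordinal value of a
-- term read as a sum ω^a₁ + … + ω^aₙ with absorption).

addTerm : Ord → Ord → Ord
addTerm a oz = ω^ a + oz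
addTerm a (ω^ b + d) with cmp a b
... | lt = ω^ b + d
... | _  = ω^ a + (ω^ b + d)

nf : Ord → Ord
nf oz = oz
nf (ω^ a + c) = addTerm (nf a) (nf c)

-- Extended Ackermann functions, given by their graph.
--   Ack α k b v    :  A_α(k,b) = v
--   Iter α k n x y :  A_α(k,·)^n (x) = y
--   FS δ l k c ε   :  δ_{l,k,c} = ε

data Ack  : Ord → ℕ → ℕ → ℕ → Set
data Iter : Ord → ℕ → ℕ → ℕ → ℕ → Set
data FS   : Ord → ℕ → ℕ → ℕ → Ord → Set

data Ack where
  a-zero : ∀ {k b} → Ack oz k b (suc b)
  a-suc0 : ∀ {β k y} → Iter β k k 0 y → Ack (osuc β) k 0 y
  a-sucS : ∀ {β k b z y} → Ack (osuc β) k b z → Iter β k k z y →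
           Ack (osuc β) k (suc b) y
  a-lim0 : ∀ {λ' k δ y} → Limit λ' → FS λ' k k 0 δ → Iter δ k k 0 y →
           Ack λ' k 0 y
  a-limS : ∀ {λ' k b z δ y} → Limit λ' → Ack λ' k b z → FS λ' k k z δ →
           Iter δ k k z y → Ack λ' k (suc b) y

data Iter where
  it-zero : ∀ {α k x} → Iter α k 0 x x
  it-suc  : ∀ {α k n x y z} → Iter α k n x y → Ack α k y z →
            Iter α k (suc n) x z

data FS where
  fs-zero : ∀ {δ k c} → FS δ 0 k c (δ [ c ])
  fs-suc  : ∀ {δ l k c ε v} → FS δ l k c ε → Ack ε k c v →
            FS δ (suc l) k c (δ [ v ])

-- A_α(k, b-1) with the convention A_α(k,-1) = 0
AckPred : Ord → ℕ → ℕ → ℕ → Set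
AckPred α k zero v = v ≡ 0
AckPred α k (suc b) v = Ack α k b v

infixr 4 _++ₒ_
_++ₒ_ : Ord → Ord → Ord
oz ++ₒ d = d
(ω^ a + c) ++ₒ d = ω^ a + (c ++ₒ d)

data Ctx : Set where
  hole : Ctx
  -- prefix + [[·]] + suffix   (prefix, suffix are CNF terms)
  mid  : Ord → Ord → Ctx
  -- prefix + ω^{μ[[·]]} + suffix
  expo : Ord → Ctx → Ord → Ctx

_⟦_⟧ : Ctx → Ord → Ord
hole ⟦ ξ ⟧ = ξ
mid p s ⟦ ξ ⟧ = p ++ₒ (ξ ++ₒ s)
expo p μ s ⟦ ξ ⟧ = p ++ₒ (ω^ (μ ⟦ ξ ⟧) + s)

_* : Ctx → Ctx
hole * = hole
mid p s * = mid p oz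
expo p μ s * = expo p (μ *) oz

module Submission where

open import Defs
open import Data.Nat using (ℕ; _≤_; _∸_)
open import Data.Product using (_×_; ∃-syntax)
open import Relation.Binary.PropositionalEquality using (_≡_)
open import Relation.Nullary using (¬_)

open import Data.Nat using (zero; suc; _<_; z≤n; s≤s)
import Data.Nat.Properties as ℕₚ
open import Data.Bool using (true; false)
open import Data.Unit using (⊤; tt)
open import Data.Empty using (⊥; ⊥-elim)
open import Data.Product using (∃; _,_; proj₁; proj₂)
open import Data.Sum using (_⊎_; inj₁; inj₂)
open import Induction.WellFounded using (Acc; acc; WfRec)
open import Level using (0ℓ)
open import Relation.Binary.Core using (Rel)
open import Relation.Binary.Definitions using (Trichotomous; Tri; tri<; tri≈; tri>)
open import Relation.Binary.Construct.Closure.ReflexiveTransitive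
  using (Star; ε; _◅_; _◅◅_)
open import Relation.Binary.PropositionalEquality
  using (_≢_; refl; sym; trans; cong; cong₂; subst)

-- Proof of Theorem 9.  Put β = λ*[[ω^(γ+1)]], c = A_β(k,b-1),
-- δ = β_{k-1,k,c} and v = A_δ(k,c), so that β_{k,k,c} = β[v].  If we had
-- v < r, then β would be a limit lying above α = λ[[ω^γ·r]] with β[v] < α
-- (context-bracket), and we show that then A_β(k,b) ≤ A_α(k,b)
-- (limit-domination), contradicting the maximality hypothesis on α.

cmp-refl : ∀ a → cmp a a ≡ eq
cmp-refl oz = refl
cmp-refl (ω^ a + c) rewrite cmp-refl a = cmp-refl c

cmp-eq : ∀ a b → cmp a b ≡ eq → a ≡ b
cmp-eq oz oz e = refl
cmp-eq (ω^ a + c) (ω^ b + d) e with cmp a b in h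
... | eq = cong₂ ω^_+_ (cmp-eq a b h) (cmp-eq c d e)

cmp-gt : ∀ a b → cmp a b ≡ gt → b <ₒ a
cmp-gt oz oz ()
cmp-gt (ω^ a + a₁) oz e = refl
cmp-gt (ω^ a + c) (ω^ b + d) e with cmp a b in h
... | gt rewrite cmp-gt a b h = refl
... | eq rewrite cmp-eq a b h | cmp-refl b = cmp-gt c d e

<ₒ-cons-inv : ∀ a c b d → (ω^ a + c) <ₒ (ω^ b + d) → a <ₒ b ⊎ (a ≡ b × c <ₒ d)
<ₒ-cons-inv a c b d e with cmp a b in h
... | lt = inj₁ refl
... | eq = inj₂ (cmp-eq a b h , e)

<ₒ-head : ∀ a c b d → a <ₒ b → (ω^ a + c) <ₒ (ω^ b + d)
<ₒ-head a c b d h rewrite h = refl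

<ₒ-tail : ∀ a c d → c <ₒ d → (ω^ a + c) <ₒ (ω^ a + d)
<ₒ-tail a c d h rewrite cmp-refl a = h

≮oz : ∀ a → ¬ (a <ₒ oz)
≮oz oz ()
≮oz (ω^ a + c) ()

<ₒ-irrefl : ∀ a → ¬ (a <ₒ a)
<ₒ-irrefl a p with () ← trans (sym (cmp-refl a)) p

<ₒ-trans : ∀ a b c → a <ₒ b → b <ₒ c → a <ₒ c
<ₒ-trans oz (ω^ b + d) (ω^ e + f) p q = refl
<ₒ-trans (ω^ a + c) (ω^ b + d) (ω^ e + f) p q
  with <ₒ-cons-inv a c b d p | <ₒ-cons-inv b d e f q
... | inj₁ x         | inj₁ y         = <ₒ-head a c e f (<ₒ-trans a b e x y)
... | inj₁ x         | inj₂ (refl , y) = <ₒ-head a c b f x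
... | inj₂ (refl , x) | inj₁ y         = <ₒ-head a c e f y
... | inj₂ (refl , x) | inj₂ (refl , y) = <ₒ-tail a c f (<ₒ-trans c d f x y)
<ₒ-trans a oz c p q = ⊥-elim (≮oz a p)
<ₒ-trans (ω^ a + c) (ω^ b + d) oz p q = ⊥-elim (≮oz (ω^ b + d) q)

<ₒ-asym : ∀ a b → a <ₒ b → ¬ (b <ₒ a)
<ₒ-asym a b p q = <ₒ-irrefl a (<ₒ-trans a b a p q)

<ₒ-cmp : Trichotomous _≡_ _<ₒ_
<ₒ-cmp a b = by-cmp (cmp a b) refl
  where
  by-cmp : ∀ o → cmp a b ≡ o → Tri (a <ₒ b) (a ≡ b) (b <ₒ a)
  by-cmp lt h = tri< h (λ { refl → <ₒ-irrefl a h }) (<ₒ-asym a b h)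
  by-cmp gt h = tri> (<ₒ-asym b a (cmp-gt a b h))
                     (λ { refl → <ₒ-irrefl a (cmp-gt a a h) }) (cmp-gt a b h)
  by-cmp eq h with cmp-eq a b h
  ... | refl = tri≈ (<ₒ-irrefl a) refl (<ₒ-irrefl a)

infix 4 _≤ₒ_
_≤ₒ_ : Ord → Ord → Set
a ≤ₒ b = ¬ (b <ₒ a)

≤ₒ-<ₒ-trans : ∀ a b c → a ≤ₒ b → b <ₒ c → a <ₒ c
≤ₒ-<ₒ-trans a b c p q with <ₒ-cmp a b
... | tri< x _ _ = <ₒ-trans a b c x q
... | tri≈ _ refl _ = q
... | tri> _ _ x = ⊥-elim (p x)

<ₒ-≤ₒ-trans : ∀ a b c → a <ₒ b → b ≤ₒ c → a <ₒ c
<ₒ-≤ₒ-trans a b c p q with <ₒ-cmp b c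
... | tri< x _ _ = <ₒ-trans a b c p x
... | tri≈ _ refl _ = p
... | tri> _ _ x = ⊥-elim (q x)

≤ₒ-trans : ∀ a b c → a ≤ₒ b → b ≤ₒ c → a ≤ₒ c
≤ₒ-trans a b c p q r = q (<ₒ-≤ₒ-trans c a b r p)

<ₒ⇒≤ₒ : ∀ a b → a <ₒ b → a ≤ₒ b
<ₒ⇒≤ₒ a b = <ₒ-asym a b

≤ₒ-tail : ∀ a c d → c ≤ₒ d → (ω^ a + c) ≤ₒ (ω^ a + d)
≤ₒ-tail a c d p q with <ₒ-cons-inv a d a c q
... | inj₁ x = <ₒ-irrefl a x
... | inj₂ (_ , x) = p x

≤ₒ-head : ∀ u v → u ≤ₒ v → (ω^ u + oz) ≤ₒ (ω^ v + oz)
≤ₒ-head u v p q with <ₒ-cons-inv v oz u oz q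
... | inj₁ r = p r
... | inj₂ (_ , r) = ≮oz oz r

osuc≢oz : ∀ x → osuc x ≢ oz
osuc≢oz oz ()
osuc≢oz (ω^ x + c) ()

isSucc-cons : ∀ a b d → isSucc (ω^ a + (ω^ b + d)) ≡ isSucc (ω^ b + d)
isSucc-cons oz b d = refl
isSucc-cons (ω^ a + c) b d = refl

isSucc-osuc : ∀ x → isSucc (osuc x) ≡ true
isSucc-osuc oz = refl
isSucc-osuc (ω^ a + oz) = isSucc-cons a oz oz
isSucc-osuc (ω^ a + (ω^ b + d)) =
  trans (isSucc-cons a b (osuc d)) (isSucc-osuc (ω^ b + d))

pred-osuc : ∀ x → pred (osuc x) ≡ x
pred-osuc oz = refl
pred-osuc (ω^ a + oz) = refl
pred-osuc (ω^ a + (ω^ b + d)) = cong (ω^ a +_) (pred-osuc (ω^ b + d))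

osuc-pred : ∀ x → isSucc x ≡ true → osuc (pred x) ≡ x
osuc-pred (ω^ oz + oz) e = refl
osuc-pred (ω^ a + (ω^ b + d)) e =
  cong (ω^ a +_) (osuc-pred (ω^ b + d) (trans (sym (isSucc-cons a b d)) e))

osuc-inj : ∀ x y → osuc x ≡ osuc y → x ≡ y
osuc-inj x y e = trans (sym (pred-osuc x)) (trans (cong pred e) (pred-osuc y))

osuc-not-limit : ∀ x → ¬ Limit (osuc x)
osuc-not-limit x (_ , h) with () ← trans (sym (isSucc-osuc x)) h

<ₒ-osuc : ∀ x → x <ₒ osuc x
<ₒ-osuc oz = refl
<ₒ-osuc (ω^ a + c) = <ₒ-tail a c (osuc c) (<ₒ-osuc c)

osuc-adjacent : ∀ x y → x <ₒ y → ¬ (y <ₒ osuc x)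
osuc-adjacent oz oz p q = ≮oz oz p
osuc-adjacent oz (ω^ a + c) p q with <ₒ-cons-inv a c oz oz q
... | inj₁ x = ≮oz a x
... | inj₂ (_ , x) = ≮oz c x
osuc-adjacent (ω^ a + c) oz p q = ≮oz (ω^ a + c) p
osuc-adjacent (ω^ a + c) (ω^ b + d) p q
  with <ₒ-cons-inv a c b d p | <ₒ-cons-inv b d a (osuc c) q
... | inj₁ x         | inj₁ y         = <ₒ-irrefl a (<ₒ-trans a b a x y)
... | inj₁ x         | inj₂ (refl , y) = <ₒ-irrefl a x
... | inj₂ (refl , x) | inj₁ y         = <ₒ-irrefl a y
... | inj₂ (refl , x) | inj₂ (_ , y)    = osuc-adjacent c d x y

<ₒ-osuc⇒≤ₒ : ∀ x y → y <ₒ osuc x → y ≤ₒ x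
<ₒ-osuc⇒≤ₒ x y p q = osuc-adjacent x y q p

pred-<ₒ : ∀ e → isSucc e ≡ true → pred e <ₒ e
pred-<ₒ e h = subst (pred e <ₒ_) (osuc-pred e h) (<ₒ-osuc (pred e))

NF-osuc : ∀ {x} → NF x → NF (osuc x)
NF-osuc nf-z = nf-s nf-z nf-z tt
NF-osuc (nf-s {a} {oz} na nc l) = nf-s na (NF-osuc nc) (≮oz a)
NF-osuc (nf-s {a} {ω^ b + d} na nc l) = nf-s na (NF-osuc nc) l

NF-osuc-inv : ∀ x → NF (osuc x) → NF x
NF-osuc-inv oz n = nf-z
NF-osuc-inv (ω^ a + oz) (nf-s na nc l) = nf-s na nf-z tt
NF-osuc-inv (ω^ a + (ω^ b + d)) (nf-s na nc l) =
  nf-s na (NF-osuc-inv (ω^ b + d) nc) l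

NF-pred : ∀ e → NF e → isSucc e ≡ true → NF (pred e)
NF-pred e n h = NF-osuc-inv (pred e) (subst NF (sym (osuc-pred e h)) n)

data Kind (α : Ord) : Set where
  zeroₖ  : α ≡ oz → Kind α
  succₖ  : ∀ x → NF x → α ≡ osuc x → Kind α
  limitₖ : Limit α → Kind α

kind : ∀ α → NF α → Kind α
kind oz n = zeroₖ refl
kind (ω^ a + c) n with isSucc (ω^ a + c) in h
... | true  = succₖ (pred (ω^ a + c)) (NF-pred _ n h) (sym (osuc-pred _ h))
... | false = limitₖ ((λ ()) , h)

-- Well-foundedness.  The order relevant for recursion is the strict order
-- restricted to normal forms; every normal form is accessible.

infix 4 _⊏_
_⊏_ : Rel Ord 0ℓ
y ⊏ x = NF y × y <ₒ x

acc-oz : Acc _⊏_ oz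
acc-oz = acc λ {y} (_ , p) → ⊥-elim (≮oz y p)

BoundedBy : Ord → Ord → Set
BoundedBy a oz = ⊤
BoundedBy a (ω^ b + _) = b <ₒ a

bounded-tail : ∀ {a} b d → b <ₒ a → LeadOK b d → BoundedBy a d
bounded-tail b oz p l = tt
bounded-tail {a} b (ω^ e + f) p l = ≤ₒ-<ₒ-trans e b a l p

mutual
  acc-cons : ∀ a → Acc _⊏_ a → NF a → ∀ c → NF c → LeadOK a c → Acc _⊏_ c →
             Acc _⊏_ (ω^ a + c)
  acc-cons a (acc rsa) na = inner
    where
    mutual
      inner : ∀ c → NF c → LeadOK a c → Acc _⊏_ c → Acc _⊏_ (ω^ a + c)
      inner c nc lc (acc rsc) = acc (below c rsc)

      below : ∀ c → WfRec _⊏_ (Acc _⊏_) c → WfRec _⊏_ (Acc _⊏_) (ω^ a + c)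
      below c rsc {oz} _ = acc-oz
      below c rsc {ω^ a' + c'} (nf-s na' nc' lc' , p) = split (<ₒ-cons-inv a' c' a c p)
        where
        split : a' <ₒ a ⊎ (a' ≡ a × c' <ₒ c) → Acc _⊏_ (ω^ a' + c')
        split (inj₁ x) = acc-cons a' (rsa (na' , x)) na' c' nc' lc'
                           (acc-bounded a rsa c' nc' (bounded-tail a' c' x lc'))
        split (inj₂ (refl , x)) = inner c' nc' lc' (rsc (nc' , x))

  acc-bounded : ∀ a → WfRec _⊏_ (Acc _⊏_) a → ∀ c → NF c → BoundedBy a c → Acc _⊏_ c
  acc-bounded a rsa oz _ _ = acc-oz
  acc-bounded a rsa (ω^ b + d) (nf-s nb nd ld) p =
    acc-cons b (rsa (nb , p)) nb d nd ld (acc-bounded a rsa d nd (bounded-tail b d p ld))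

wf : ∀ {α} → NF α → Acc _⊏_ α
wf nf-z = acc-oz
wf (nf-s na nc l) = acc-cons _ (wf na) na _ nc l (wf nc)

LeadOK-≤ₒ : ∀ a c d → LeadOK a c → d ≤ₒ c → LeadOK a d
LeadOK-≤ₒ a c oz l p = tt
LeadOK-≤ₒ a oz (ω^ b + e) l p = ⊥-elim (p refl)
LeadOK-≤ₒ a (ω^ b' + e') (ω^ b + e) l p q with <ₒ-cmp b' b
... | tri< x _ _ = p (<ₒ-head b' e' b e x)
... | tri≈ _ refl _ = l q
... | tri> _ _ x = l (<ₒ-trans a b b' q x)

NF-rep : ∀ e X → NF e → NF (rep e X)
NF-rep e zero n = nf-z
NF-rep e (suc zero) n = nf-s n nf-z tt
NF-rep e (suc (suc X)) n = nf-s n (NF-rep e (suc X) n) (<ₒ-irrefl e)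

rep-mono : ∀ e x X → x ≤ X → rep e x ≤ₒ rep e X
rep-mono e zero X p = ≮oz (rep e X)
rep-mono e (suc x) (suc X) (s≤s p) = ≤ₒ-tail e (rep e x) (rep e X) (rep-mono e x X p)

rep-<ₒ : ∀ e X a c → e <ₒ a → rep e X <ₒ (ω^ a + c)
rep-<ₒ e zero a c p = refl
rep-<ₒ e (suc X) a c p = <ₒ-head e _ a c p

fs-< : ∀ β → NF β → β ≢ oz → ∀ X → (β [ X ]) <ₒ β
fs-< oz _ β≢oz X = ⊥-elim (β≢oz refl)
fs-< (ω^ a + (ω^ b + d)) (nf-s _ nc _) _ X =
  <ₒ-tail a ((ω^ b + d) [ X ]) (ω^ b + d) (fs-< (ω^ b + d) nc (λ ()) X)
fs-< (ω^ oz + oz) _ _ X = refl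
fs-< (ω^ (ω^ a + c) + oz) (nf-s ne _ _) _ X with isSucc (ω^ a + c) in h
... | true = rep-<ₒ (pred (ω^ a + c)) X (ω^ a + c) oz (pred-<ₒ (ω^ a + c) h)
... | false = <ₒ-head ((ω^ a + c) [ X ]) oz (ω^ a + c) oz (fs-< (ω^ a + c) ne (λ ()) X)

fs-NF : ∀ β → NF β → ∀ X → NF (β [ X ])
fs-NF oz n X = nf-z
fs-NF (ω^ a + (ω^ b + d)) (nf-s na nc l) X =
  nf-s na (fs-NF (ω^ b + d) nc X)
       (LeadOK-≤ₒ a (ω^ b + d) ((ω^ b + d) [ X ]) l
          (<ₒ⇒≤ₒ ((ω^ b + d) [ X ]) (ω^ b + d) (fs-< (ω^ b + d) nc (λ ()) X)))
fs-NF (ω^ oz + oz) n X = nf-z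
fs-NF (ω^ (ω^ a + c) + oz) (nf-s ne _ _) X with isSucc (ω^ a + c) in h
... | true = NF-rep (pred (ω^ a + c)) X (NF-pred (ω^ a + c) ne h)
... | false = nf-s (fs-NF (ω^ a + c) ne X) nf-z tt

fs-⊏ : ∀ {β} → NF β → β ≢ oz → ∀ X → (β [ X ]) ⊏ β
fs-⊏ {β} n β≢oz X = fs-NF β n X , fs-< β n β≢oz X

fs-mono : ∀ β → NF β → ∀ x X → x ≤ X → β [ x ] ≤ₒ β [ X ]
fs-mono oz _ x X p = <ₒ-irrefl oz
fs-mono (ω^ a + (ω^ b + d)) (nf-s _ nc _) x X p =
  ≤ₒ-tail a ((ω^ b + d) [ x ]) ((ω^ b + d) [ X ]) (fs-mono (ω^ b + d) nc x X p)
fs-mono (ω^ oz + oz) _ x X p = <ₒ-irrefl oz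
fs-mono (ω^ (ω^ a + c) + oz) (nf-s ne _ _) x X p with isSucc (ω^ a + c)
... | true = rep-mono (pred (ω^ a + c)) x X p
... | false = ≤ₒ-head ((ω^ a + c) [ x ]) ((ω^ a + c) [ X ]) (fs-mono (ω^ a + c) ne x X p)

limit-tail : ∀ a b d → Limit (ω^ a + (ω^ b + d)) → Limit (ω^ b + d)
limit-tail a b d (_ , h) = (λ ()) , trans (sym (isSucc-cons a b d)) h

bachmann-rep : ∀ e N η → NF η → Limit η → rep e N <ₒ η → η <ₒ (ω^ (osuc e) + oz) →
  rep e N ≤ₒ (η [ 1 ])
bachmann-rep e zero η n l p q = ≮oz (η [ 1 ])
bachmann-rep e (suc N) oz n l p q = ⊥-elim (≮oz (rep e (suc N)) p)
bachmann-rep e (suc N) (ω^ f + d) (nf-s nf nd ld) l p q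
  with <ₒ-cons-inv e (rep e N) f d p | <ₒ-cons-inv f d (osuc e) oz q
... | _ | inj₂ (_ , r) = ⊥-elim (≮oz d r)
... | inj₁ x | inj₁ y = ⊥-elim (osuc-adjacent e f x y)
... | inj₂ (refl , x) | inj₁ y with d
...   | oz = ⊥-elim (≮oz (rep e N) x)
...   | ω^ b' + d' =
  ≤ₒ-tail e (rep e N) ((ω^ b' + d') [ 1 ])
    (bachmann-rep e N (ω^ b' + d') nd (limit-tail e b' d' l) x
      (<ₒ-head b' d' (osuc e) oz (≤ₒ-<ₒ-trans b' e (osuc e) ld (<ₒ-osuc e))))

bachmann : ∀ β → NF β → Limit β → ∀ N η → NF η → Limit η → (β [ N ]) <ₒ η → η <ₒ β →
  β [ N ] ≤ₒ η [ 1 ]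
bachmann oz nb lb N η nη lη p q = ⊥-elim (proj₁ lb refl)
bachmann (ω^ a + (ω^ b + d)) nb lb N oz nη lη p q = ⊥-elim (≮oz ((ω^ a + (ω^ b + d)) [ N ]) p)
bachmann (ω^ a + (ω^ b + d)) (nf-s na nc l) lb N (ω^ a' + c') (nf-s na' nc' l') lη p q
  with <ₒ-cons-inv a ((ω^ b + d) [ N ]) a' c' p | <ₒ-cons-inv a' c' a (ω^ b + d) q
... | inj₁ x         | inj₁ y         = ⊥-elim (<ₒ-irrefl a (<ₒ-trans a a' a x y))
... | inj₁ x         | inj₂ (refl , y) = ⊥-elim (<ₒ-irrefl a x)
... | inj₂ (refl , x) | inj₁ y         = ⊥-elim (<ₒ-irrefl a y)
... | inj₂ (refl , x) | inj₂ (_ , y) with c'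
...   | oz = ⊥-elim (≮oz ((ω^ b + d) [ N ]) x)
...   | ω^ b' + d' = ≤ₒ-tail a ((ω^ b + d) [ N ]) ((ω^ b' + d') [ 1 ])
          (bachmann (ω^ b + d) nc (limit-tail a b d lb) N (ω^ b' + d') nc'
             (limit-tail a b' d' lη) x y)
bachmann (ω^ oz + oz) nb (_ , ()) N η nη lη p q
bachmann (ω^ (ω^ a1 + a2) + oz) (nf-s na _ _) lb N η nη lη p q with isSucc (ω^ a1 + a2) in h
... | true = bachmann-rep (pred (ω^ a1 + a2)) N η nη lη p
               (subst (λ z → η <ₒ (ω^ z + oz)) (sym (osuc-pred _ h)) q)
... | false = exponent η nη lη p q
  where
  -- β = ω^a with a a limit: compare exponents
  a = ω^ a1 + a2
  exponent : ∀ η → NF η → Limit η → (ω^ (a [ N ]) + oz) <ₒ η → η <ₒ (ω^ a + oz) →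
             (ω^ (a [ N ]) + oz) ≤ₒ (η [ 1 ])
  exponent oz _ _ p q = ⊥-elim (≮oz (ω^ (a [ N ]) + oz) p)
  exponent (ω^ f + d) (nf-s nf nd ld) lη p q
    with <ₒ-cons-inv (a [ N ]) oz f d p | <ₒ-cons-inv f d a oz q
  ... | _ | inj₂ (_ , r) = ⊥-elim (≮oz d r)
  ... | inj₂ (refl , x) | inj₁ y with d
  ...   | oz = ⊥-elim (≮oz oz x)
  ...   | ω^ b' + d' = ≤ₒ-tail (a [ N ]) oz ((ω^ b' + d') [ 1 ]) (≮oz ((ω^ b' + d') [ 1 ]))
  exponent (ω^ f + d) (nf-s nf nd ld) lη p q | inj₁ x | inj₁ y with d
  ... | ω^ b' + d' = <ₒ⇒≤ₒ (ω^ (a [ N ]) + oz) (ω^ f + ((ω^ b' + d') [ 1 ]))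
                       (<ₒ-head (a [ N ]) oz f ((ω^ b' + d') [ 1 ]) x)
  ... | oz with f
  ...   | oz = ⊥-elim (≮oz (a [ N ]) x)
  ...   | ω^ f1 + f2 with isSucc (ω^ f1 + f2) in h'
  ...     | true = ≤ₒ-head (a [ N ]) (pred (ω^ f1 + f2))
                     (<ₒ-osuc⇒≤ₒ (pred (ω^ f1 + f2)) (a [ N ])
                        (subst ((a [ N ]) <ₒ_) (sym (osuc-pred _ h')) x))
  ...     | false = ≤ₒ-head (a [ N ]) ((ω^ f1 + f2) [ 1 ])
                      (bachmann a na ((λ ()) , h) N (ω^ f1 + f2) nf ((λ ()) , h') x y)

data Step (η : Ord) : Ord → Set where
  step-succ  : ∀ {x} → η ≡ osuc x → Step η x
  step-limit : Limit η → Step η (η [ 1 ])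

-- The ordinal α' whose iterate defines A_α(k, y): the predecessor of a
-- successor α, or some α[X] with X ≥ 1 for a limit α.
data Descent (α : Ord) : Ord → Set where
  desc-succ  : ∀ {x} → α ≡ osuc x → Descent α x
  desc-limit : ∀ {X} → Limit α → 1 ≤ X → Descent α (α [ X ])

step⇒descent : ∀ {η η'} → Step η η' → Descent η η'
step⇒descent (step-succ e) = desc-succ e
step⇒descent (step-limit l) = desc-limit l ℕₚ.≤-refl

descent-⊏ : ∀ {α α'} → NF α → Descent α α' → α' ⊏ α
descent-⊏ nα (desc-succ {x} refl) = NF-osuc-inv x nα , <ₒ-osuc x
descent-⊏ nα (desc-limit {X} l _) = fs-⊏ nα (proj₁ l) X

-- For a limit β, every η with β[N] ≤ η < β reaches β[N] by one-steps: a
-- successor steps to its predecessor, a limit η to η[1], which stays above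
-- β[N] by the Bachmann property.
reach : ∀ {β} → NF β → Limit β → ∀ N {η} → NF η → β [ N ] ≤ₒ η → η <ₒ β →
        Star Step η (β [ N ])
reach {β} nβ lβ N nη = go (wf nη) nη
  where
  go : ∀ {η} → Acc _⊏_ η → NF η → β [ N ] ≤ₒ η → η <ₒ β → Star Step η (β [ N ])
  go {η} (acc rs) nη p q with <ₒ-cmp (β [ N ]) η
  ... | tri≈ _ e _ = subst (Star Step η) (sym e) ε
  ... | tri> _ _ x = ⊥-elim (p x)
  ... | tri< x _ _ with kind η nη
  ...   | zeroₖ refl = ⊥-elim (≮oz (β [ N ]) x)
  ...   | succₖ y ny refl =
    step-succ refl ◅ go (rs (ny , <ₒ-osuc y)) ny (<ₒ-osuc⇒≤ₒ y (β [ N ]) x)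
                        (<ₒ-trans y (osuc y) β (<ₒ-osuc y) q)
  ...   | limitₖ l =
    step-limit l ◅ go (rs (fs-⊏ nη (proj₁ l) 1)) (fs-NF η nη 1)
                      (bachmann β nβ lβ N η nη l x q)
                      (<ₒ-trans (η [ 1 ]) η β (fs-< η nη (proj₁ l) 1) q)

fs-reach : ∀ {β} → NF β → Limit β → ∀ {x X} → x ≤ X → Star Step (β [ X ]) (β [ x ])
fs-reach {β} nβ lβ {x} {X} x≤X =
  reach nβ lβ x (fs-NF β nβ X) (fs-mono β nβ x X x≤X) (fs-< β nβ (proj₁ lβ) X)

mutual
  Ack-det : ∀ {α α' k y v v'} → Ack α k y v → Ack α' k y v' → α ≡ α' → v ≡ v'
  Ack-det a-zero a-zero e = refl
  Ack-det a-zero (a-suc0 {β} _) e = ⊥-elim (osuc≢oz β (sym e))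
  Ack-det a-zero (a-sucS {β} _ _) e = ⊥-elim (osuc≢oz β (sym e))
  Ack-det a-zero (a-lim0 l _ _) e = ⊥-elim (proj₁ l (sym e))
  Ack-det a-zero (a-limS l _ _ _) e = ⊥-elim (proj₁ l (sym e))
  Ack-det (a-suc0 {β} _) a-zero e = ⊥-elim (osuc≢oz β e)
  Ack-det (a-sucS {β} _ _) a-zero e = ⊥-elim (osuc≢oz β e)
  Ack-det (a-lim0 l _ _) a-zero e = ⊥-elim (proj₁ l e)
  Ack-det (a-limS l _ _ _) a-zero e = ⊥-elim (proj₁ l e)
  Ack-det (a-suc0 {β} it) (a-suc0 {β'} it') e = Iter-det it it' (osuc-inj β β' e) refl
  Ack-det (a-suc0 {β} _) (a-lim0 l _ _) e = ⊥-elim (osuc-not-limit β (subst Limit (sym e) l))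
  Ack-det (a-lim0 l _ _) (a-suc0 {β} _) e = ⊥-elim (osuc-not-limit β (subst Limit e l))
  Ack-det (a-sucS {β} d it) (a-sucS {β'} d' it') e =
    Iter-det it it' (osuc-inj β β' e) (Ack-det d d' e)
  Ack-det (a-sucS {β} _ _) (a-limS l _ _ _) e = ⊥-elim (osuc-not-limit β (subst Limit (sym e) l))
  Ack-det (a-limS l _ _ _) (a-sucS {β} _ _) e = ⊥-elim (osuc-not-limit β (subst Limit e l))
  Ack-det (a-lim0 _ fs it) (a-lim0 _ fs' it') e = Iter-det it it' (FS-det fs fs' e refl) refl
  Ack-det (a-limS _ d fs it) (a-limS _ d' fs' it') e with Ack-det d d' e
  ... | refl = Iter-det it it' (FS-det fs fs' e refl) refl

  Iter-det : ∀ {α α' k n x x' y y'} → Iter α k n x y → Iter α' k n x' y' →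
             α ≡ α' → x ≡ x' → y ≡ y'
  Iter-det it-zero it-zero e ex = ex
  Iter-det (it-suc it d) (it-suc it' d') e ex with Iter-det it it' e ex
  ... | refl = Ack-det d d' e

  FS-det : ∀ {δ δ' l k c c' ε ε'} → FS δ l k c ε → FS δ' l k c' ε' →
           δ ≡ δ' → c ≡ c' → ε ≡ ε'
  FS-det fs-zero fs-zero refl refl = refl
  FS-det {δ = δ} (fs-suc fs d) (fs-suc fs' d') refl refl with FS-det fs fs' refl refl
  ... | refl = cong (δ [_]) (Ack-det d d' refl)

mutual
  Ack-infl : ∀ {α k y v} → Ack α (suc k) y v → y < v
  Ack-infl a-zero = ℕₚ.≤-refl
  Ack-infl (a-suc0 it) = Iter-strict it
  Ack-infl (a-sucS d it) = ℕₚ.<-≤-trans (s≤s (Ack-infl d)) (Iter-strict it)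
  Ack-infl (a-lim0 l fs it) = Iter-strict it
  Ack-infl (a-limS l d fs it) = ℕₚ.<-≤-trans (s≤s (Ack-infl d)) (Iter-strict it)

  Iter-infl : ∀ {α k n x z} → Iter α (suc k) n x z → x ≤ z
  Iter-infl it-zero = ℕₚ.≤-refl
  Iter-infl (it-suc it d) = ℕₚ.≤-trans (Iter-infl it) (ℕₚ.<⇒≤ (Ack-infl d))

  Iter-strict : ∀ {α k n x z} → Iter α (suc k) (suc n) x z → x < z
  Iter-strict (it-suc it d) = ℕₚ.≤-<-trans (Iter-infl it) (Ack-infl d)

Ack-positive : ∀ {α k y v} → Ack α (suc k) y v → 1 ≤ v
Ack-positive d = ℕₚ.≤-trans (s≤s z≤n) (Ack-infl d)

AckPred-infl : ∀ {α k y c} → AckPred α (suc k) y c → y ≤ c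
AckPred-infl {y = zero} p = z≤n
AckPred-infl {y = suc y} p = Ack-infl p

Ack-prev : ∀ {α k y v} → Ack α k (suc y) v → ∃ (Ack α k y)
Ack-prev a-zero = _ , a-zero
Ack-prev (a-sucS d _) = _ , d
Ack-prev (a-limS _ d _ _) = _ , d

Ack-increasing : ∀ {α k y v v'} → Ack α (suc k) y v → Ack α (suc k) (suc y) v' → v < v'
Ack-increasing d a-zero rewrite Ack-det d a-zero refl = ℕₚ.≤-refl
Ack-increasing d (a-sucS d' it) rewrite Ack-det d d' refl = Iter-strict it
Ack-increasing d (a-limS l d' fs it) rewrite Ack-det d d' refl = Iter-strict it

Ack-mono : ∀ {α k y y' v v'} → y ≤ y' → Ack α (suc k) y v → Ack α (suc k) y' v' → v ≤ v'
Ack-mono {y' = zero} z≤n d d' = ℕₚ.≤-reflexive (Ack-det d d' refl)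
Ack-mono {y' = suc y'} p d d' with ℕₚ.m≤n⇒m<n∨m≡n p
... | inj₂ refl = ℕₚ.≤-reflexive (Ack-det d d' refl)
... | inj₁ (s≤s q) with Ack-prev d'
... | (z , dz) = ℕₚ.≤-trans (Ack-mono q d dz) (ℕₚ.<⇒≤ (Ack-increasing dz d'))

AckPred-mono : ∀ {α k y b c₁ c₂} → y ≤ b →
  AckPred α (suc k) y c₁ → AckPred α (suc k) b c₂ → c₁ ≤ c₂
AckPred-mono {y = zero} _ refl _ = z≤n
AckPred-mono {y = suc y} {suc b} (s≤s y≤b) d₁ d₂ = Ack-mono y≤b d₁ d₂

Iter-bound : ∀ {α k n y c w v} → y ≤ c → Ack α (suc k) y w → Iter α (suc k) (suc n) c v → w ≤ v
Iter-bound y≤c d (it-suc it d') = Ack-mono (ℕₚ.≤-trans y≤c (Iter-infl it)) d d'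

Iter-dominated : ∀ {f g k n x x' a b} →
  (∀ {z a b} → Ack f (suc k) z a → Ack g (suc k) z b → a ≤ b) →
  (∀ z → ∃ (Ack g (suc k) z)) →
  Iter f (suc k) n x a → Iter g (suc k) n x' b → x ≤ x' → a ≤ b
Iter-dominated below tg it-zero it-zero p = p
Iter-dominated below tg (it-suc {y = a₁} it d) (it-suc it' d') p with tg a₁
... | (w , dw) = ℕₚ.≤-trans (below d dw) (Ack-mono (Iter-dominated below tg it it' p) dw d')

FS-member : ∀ {β l k c δ} → FS β l k c δ → ∃[ X ] δ ≡ β [ X ]
FS-member {c = c} fs-zero = c , refl
FS-member (fs-suc {v = v} _ _) = v , refl

FS-NF : ∀ {β l k c δ} → NF β → FS β l k c δ → NF δ
FS-NF {β} nβ fs with FS-member fs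
... | (X , refl) = fs-NF β nβ X

Iter-total : ∀ {α k} → (∀ z → ∃ (Ack α k z)) → ∀ n x → ∃ (Iter α k n x)
Iter-total t zero x = x , it-zero
Iter-total t (suc n) x with Iter-total t n x
... | (y , it) with t y
... | (z , d) = z , it-suc it d

FS-Ack-total : ∀ {β l k c δ} → (∀ X z → ∃ (Ack (β [ X ]) k z)) → FS β l k c δ →
  ∀ z → ∃ (Ack δ k z)
FS-Ack-total t fs with FS-member fs
... | (X , refl) = t X

FS-total-from : ∀ {β k} → (∀ X z → ∃ (Ack (β [ X ]) k z)) → ∀ l c → ∃ (FS β l k c)
FS-total-from t zero c = _ , fs-zero
FS-total-from t (suc l) c =
  let (δ , fs) = FS-total-from t l c
      (v , d) = FS-Ack-total t fs c
  in _ , fs-suc fs d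

Ack-total-succ : ∀ {x k} → (∀ z → ∃ (Ack x k z)) → ∀ y → ∃ (Ack (osuc x) k y)
Ack-total-succ {k = k} t zero =
  let (v , it) = Iter-total t k 0 in v , a-suc0 it
Ack-total-succ {k = k} t (suc y) =
  let (z , d) = Ack-total-succ t y
      (v , it) = Iter-total t k z
  in v , a-sucS d it

Ack-total-limit : ∀ {η k} → Limit η → (∀ X z → ∃ (Ack (η [ X ]) k z)) → ∀ y → ∃ (Ack η k y)
Ack-total-limit {k = k} l t zero =
  let (δ , fs) = FS-total-from t k 0
      (v , it) = Iter-total (FS-Ack-total t fs) k 0
  in v , a-lim0 l fs it
Ack-total-limit {k = k} l t (suc y) =
  let (z , d) = Ack-total-limit l t y
      (δ , fs) = FS-total-from t k z
      (v , it) = Iter-total (FS-Ack-total t fs) k z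
  in v , a-limS l d fs it

Ack-total : ∀ {α} → NF α → ∀ k y → ∃ (Ack α k y)
Ack-total nα k = go (wf nα) nα
  where
  go : ∀ {α} → Acc _⊏_ α → NF α → ∀ y → ∃ (Ack α k y)
  go {α} (acc rs) nα with kind α nα
  ... | zeroₖ refl = λ y → _ , a-zero
  ... | succₖ x nx refl = Ack-total-succ (go (rs (nx , <ₒ-osuc x)) nx)
  ... | limitₖ l = Ack-total-limit l (λ X → go (rs (fs-⊏ nα (proj₁ l) X)) (fs-NF α nα X))

AckPred-total : ∀ {α} → NF α → ∀ k b → ∃ (AckPred α k b)
AckPred-total nα k zero = 0 , refl
AckPred-total nα k (suc b) = Ack-total nα k b

FS-total : ∀ {β} → NF β → ∀ l k c → ∃ (FS β l k c)
FS-total {β} nβ l k = FS-total-from (λ X → Ack-total (fs-NF β nβ X) k) l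

Ack-unfold : ∀ {α k y w} → α ≢ oz → Ack α (suc k) y w →
  ∃[ c ] ∃[ α' ] AckPred α (suc k) y c × Descent α α' × Iter α' (suc k) (suc k) c w
Ack-unfold α≢oz a-zero = ⊥-elim (α≢oz refl)
Ack-unfold _ (a-suc0 it) = 0 , _ , refl , desc-succ refl , it
Ack-unfold _ (a-sucS d it) = _ , _ , d , desc-succ refl , it
Ack-unfold _ (a-lim0 l (fs-suc _ dX) it) = 0 , _ , refl , desc-limit l (Ack-positive dX) , it
Ack-unfold _ (a-limS l d (fs-suc _ dX) it) = _ , _ , d , desc-limit l (Ack-positive dX) , it

Ack-unfold-limit : ∀ {η k y v} → Limit η → Ack η k y v →
  ∃[ c ] ∃[ δ ] AckPred η k y c × FS η k k c δ × Iter δ k k c v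
Ack-unfold-limit l a-zero = ⊥-elim (proj₁ l refl)
Ack-unfold-limit l (a-suc0 {β} _) = ⊥-elim (osuc-not-limit β l)
Ack-unfold-limit l (a-sucS {β} _ _) = ⊥-elim (osuc-not-limit β l)
Ack-unfold-limit l (a-lim0 _ fs it) = 0 , _ , refl , fs , it
Ack-unfold-limit l (a-limS _ d fs it) = _ , _ , d , fs , it

step-≢oz : ∀ {η η'} → Step η η' → η ≢ oz
step-≢oz (step-succ e) η≡oz = osuc≢oz _ (trans (sym e) η≡oz)
step-≢oz (step-limit l) = proj₁ l

-- The Ackermann functions decrease along one-steps: if η reaches ξ, then
-- A_ξ(k,y) ≤ A_η(k,y) for k ≥ 1.  For a step from a limit η to η[1] the
-- unfolding of A_η goes through some η[X] with X ≥ 1, and η[X] reaches η[1],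
-- so well-founded recursion on η applies.
Ack-reach-mono : ∀ {k η ξ y u v} → NF η → Star Step η ξ →
  Ack ξ (suc k) y u → Ack η (suc k) y v → u ≤ v
Ack-reach-mono nη = go (wf nη) nη
  where
  go : ∀ {k η ξ y u v} → Acc _⊏_ η → NF η → Star Step η ξ →
       Ack ξ (suc k) y u → Ack η (suc k) y v → u ≤ v
  go _ _ ε du dv = ℕₚ.≤-reflexive (Ack-det du dv refl)
  go {k} {η} {y = y} (acc rs) nη (s ◅ path) du dv =
    let (nη' , η'<η) = descent-⊏ nη (step⇒descent s)
        (v' , dv') = Ack-total nη' (suc k) y
    in ℕₚ.≤-trans (go (rs (nη' , η'<η)) nη' path du dv') (one-step s dv' dv)
    where
    -- the first step: A_η'(y) ≤ A_α'(y) ≤ A_α'^k(c) = A_η(y)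
    one-step : ∀ {η' v' v} → Step η η' → Ack η' (suc k) y v' → Ack η (suc k) y v → v' ≤ v
    one-step s dv' dv =
      let (c , α' , pc , desc , it) = Ack-unfold (step-≢oz s) dv
          (w , dw) = Ack-total (proj₁ (descent-⊏ nη desc)) (suc k) y
      in ℕₚ.≤-trans (toward s desc dv' dw) (Iter-bound (AckPred-infl pc) dw it)
      where
      toward : ∀ {η' α' v' w} → Step η η' → Descent η α' →
               Ack η' (suc k) y v' → Ack α' (suc k) y w → v' ≤ w
      toward (step-succ e) (desc-succ e') dv' dw =
        ℕₚ.≤-reflexive (Ack-det dv' dw (osuc-inj _ _ (trans (sym e) e')))
      toward (step-succ e) (desc-limit l _) _ _ = ⊥-elim (osuc-not-limit _ (subst Limit e l))
      toward (step-limit l) (desc-succ e) _ _ = ⊥-elim (osuc-not-limit _ (subst Limit e l))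
      toward (step-limit l) (desc-limit {X} _ 1≤X) dv' dw =
        go (rs (fs-⊏ nη (proj₁ l) X)) (fs-NF η nη X) (fs-reach nη l 1≤X) dv' dw

FS-reach : ∀ {β l k c₁ c₂ δ₁ δ₂} → NF β → Limit β → c₁ ≤ c₂ →
  FS β l (suc k) c₁ δ₁ → FS β l (suc k) c₂ δ₂ → Star Step δ₂ δ₁
FS-reach nβ lβ c₁≤c₂ fs-zero fs-zero = fs-reach nβ lβ c₁≤c₂
FS-reach {k = k} {c₁ = c₁} nβ lβ c₁≤c₂ (fs-suc fs₁ d₁) (fs-suc fs₂ d₂) =
  let nε₂ = FS-NF nβ fs₂
      (w , dw) = Ack-total nε₂ (suc k) c₁
  in fs-reach nβ lβ
       (ℕₚ.≤-trans (Ack-reach-mono nε₂ (FS-reach nβ lβ c₁≤c₂ fs₁ fs₂) d₁ dw)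
                   (Ack-mono c₁≤c₂ dw d₂))

≮-from-cmp : ∀ a b {o} → cmp a b ≡ o → o ≢ lt → ¬ (a <ₒ b)
≮-from-cmp a b h o≢lt q = o≢lt (trans (sym h) q)

addTerm-NF : ∀ a c → NF a → NF c → NF (addTerm a c)
addTerm-NF a oz na nc = nf-s na nf-z tt
addTerm-NF a (ω^ b + d) na nc with cmp a b in h
... | lt = nc
... | eq = nf-s na nc (≮-from-cmp a b h (λ ()))
... | gt = nf-s na nc (≮-from-cmp a b h (λ ()))

NF-nf : ∀ x → NF (nf x)
NF-nf oz = nf-z
NF-nf (ω^ a + c) = addTerm-NF (nf a) (nf c) (NF-nf a) (NF-nf c)

nf-id : ∀ {x} → NF x → nf x ≡ x
nf-id nf-z = refl
nf-id (nf-s {a} {oz} na nc l) rewrite nf-id na = refl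
nf-id (nf-s {a} {ω^ b + d} na nc l) rewrite nf-id na | nf-id nc with cmp a b in h
... | lt = ⊥-elim (l refl)
... | eq = refl
... | gt = refl

NF-suffix : ∀ p q → NF (p ++ₒ q) → NF q
NF-suffix oz q n = n
NF-suffix (ω^ a + p) q (nf-s _ n _) = NF-suffix p q n

NF-exponent : ∀ {a c} → NF (ω^ a + c) → NF a
NF-exponent (nf-s na _ _) = na

++ₒ-oz : ∀ x → (x ++ₒ oz) ≡ x
++ₒ-oz oz = refl
++ₒ-oz (ω^ a + c) = cong (ω^ a +_) (++ₒ-oz c)

tail-<ₒ : ∀ a t → NF (ω^ a + t) → t <ₒ (ω^ a + t)
tail-<ₒ a oz n = refl
tail-<ₒ a (ω^ b + d) (nf-s na (nf-s nb nd ld) l) with <ₒ-cmp b a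
... | tri< x _ _ = <ₒ-head b d a _ x
... | tri≈ _ refl _ = <ₒ-tail b d (ω^ b + d) (tail-<ₒ b d (nf-s nb nd ld))
... | tri> _ _ x = ⊥-elim (l x)

-- The
-- ordinal β = λ*[[ω^(γ+1)]] of the theorem brackets α = λ[[ω^γ·r]] at every
-- N < r; this is proved by induction on the context λ.
record Brackets (N : ℕ) (α B : Ord) : Set where
  constructor bracket
  field
    limit-NF : NF B
    limit    : Limit B
    above    : α <ₒ B
    below    : (B [ N ]) <ₒ α

ω^osuc-limit : ∀ γ → Limit (ω^ (osuc γ) + oz)
ω^osuc-limit oz = (λ ()) , refl
ω^osuc-limit (ω^ g + h) = (λ ()) , refl

ω^osuc-fs : ∀ γ N → (ω^ (osuc γ) + oz) [ N ] ≡ rep γ N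
ω^osuc-fs oz N = refl
ω^osuc-fs (ω^ g + h) N rewrite isSucc-osuc (ω^ g + h) | pred-osuc (ω^ g + h) = refl

rep-<ₒ-rep : ∀ γ N r s → N < r → rep γ N <ₒ (rep γ r ++ₒ s)
rep-<ₒ-rep γ zero (suc r) s p = refl
rep-<ₒ-rep γ (suc N) (suc r) s (s≤s p) =
  <ₒ-tail γ (rep γ N) (rep γ r ++ₒ s) (rep-<ₒ-rep γ N r s p)

bracket-rep : ∀ {N γ r} s → NF γ → N < r →
  Brackets N (rep γ r ++ₒ s) (nf (ω^ (osuc γ) + oz))
bracket-rep {N} {γ} {suc r} s nγ N<r rewrite nf-id (NF-osuc nγ) =
  bracket (nf-s (NF-osuc nγ) nf-z tt) (ω^osuc-limit γ)
          (<ₒ-head γ _ (osuc γ) oz (<ₒ-osuc γ))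
          (subst (_<ₒ (rep γ (suc r) ++ₒ s)) (sym (ω^osuc-fs γ N))
                 (rep-<ₒ-rep γ N (suc r) s N<r))

ω^-fs : ∀ {B} N → Limit B → (ω^ B + oz) [ N ] ≡ ω^ (B [ N ]) + oz
ω^-fs {oz} N (B≢oz , _) = ⊥-elim (B≢oz refl)
ω^-fs {ω^ b + d} N (_ , notSucc) rewrite notSucc = refl

bracket-exp : ∀ {N α B} s → Brackets N α B → Brackets N (ω^ α + s) (ω^ B + oz)
bracket-exp {N} {α} {B} s (bracket nB lB α<B B[N]<α) =
  bracket (nf-s nB nf-z tt) (limit-ω^ lB)
          (<ₒ-head α s B oz α<B)
          (subst (_<ₒ (ω^ α + s)) (sym (ω^-fs N lB)) (<ₒ-head (B [ N ]) oz α s B[N]<α))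
  where
  limit-ω^ : ∀ {B} → Limit B → Limit (ω^ B + oz)
  limit-ω^ {oz} (B≢oz , _) = ⊥-elim (B≢oz refl)
  limit-ω^ {ω^ _ + _} _ = (λ ()) , refl

bracket-prepend : ∀ {N a α b d} → NF a → ¬ (a <ₒ b) →
  Brackets N α (ω^ b + d) → Brackets N (ω^ a + α) (ω^ a + (ω^ b + d))
bracket-prepend {N} {a} {α} {b} {d} na a≮b (bracket nB (_ , notSucc) α<B B[N]<α) =
  bracket (nf-s na nB a≮b) ((λ ()) , trans (isSucc-cons a b d) notSucc)
          (<ₒ-tail a α (ω^ b + d) α<B)
          (<ₒ-tail a ((ω^ b + d) [ N ]) α B[N]<α)

bracket-cons : ∀ {N a α} B → NF (ω^ a + α) → Brackets N α B →
  Brackets N (ω^ a + α) (addTerm a B)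
bracket-cons oz _ br = ⊥-elim (proj₁ (Brackets.limit br) refl)
bracket-cons {N} {a} {α} (ω^ b + d) nx@(nf-s na _ _) br with cmp a b in h
... | lt = bracket (Brackets.limit-NF br) (Brackets.limit br) (<ₒ-head a α b d h)
                   (<ₒ-trans ((ω^ b + d) [ N ]) α (ω^ a + α)
                             (Brackets.below br) (tail-<ₒ a α nx))
... | eq = bracket-prepend na (≮-from-cmp a b h (λ ())) br
... | gt = bracket-prepend na (≮-from-cmp a b h (λ ())) br

bracket-prefix : ∀ {N} p {α Y} → Brackets N α (nf Y) → NF (p ++ₒ α) →
  Brackets N (p ++ₒ α) (nf (p ++ₒ Y))
bracket-prefix oz br _ = br
bracket-prefix (ω^ a + p) {α} {Y} br (nf-s na n l) rewrite nf-id na =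
  bracket-cons (nf (p ++ₒ Y)) (nf-s na n l) (bracket-prefix p br n)

context-bracket : ∀ lam {γ r N} → NF γ → NF (lam ⟦ rep γ r ⟧) → N < r →
  Brackets N (lam ⟦ rep γ r ⟧) (nf ((lam *) ⟦ ω^ (osuc γ) + oz ⟧))
context-bracket hole {γ} {r} nγ _ N<r =
  subst (λ α → Brackets _ α _) (++ₒ-oz (rep γ r)) (bracket-rep oz nγ N<r)
context-bracket (mid p s) nγ nα N<r = bracket-prefix p (bracket-rep s nγ N<r) nα
context-bracket (expo p μ s) {γ} {r} nγ nα N<r =
  bracket-prefix p
    (bracket-exp s (context-bracket μ nγ
       (NF-exponent (NF-suffix p (ω^ (μ ⟦ rep γ r ⟧) + s) nα)) N<r))
    nα

-- If β is a limit and β[v] < α < β, then every Descent α' of α reaches β[v]: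
-- for α = x + 1 because β[v] ≤ x < β, for a limit α because
-- β[v] ≤ α[1] ≤ α[X] (Bachmann property) and α[X] < α < β.
descent-reach : ∀ {β α α' v} → NF β → Limit β → NF α → (β [ v ]) <ₒ α → α <ₒ β →
  Descent α α' → Star Step α' (β [ v ])
descent-reach {β} {v = v} nβ lβ nα βv<α α<β (desc-succ {x} refl) =
  reach nβ lβ v (NF-osuc-inv x nα) (<ₒ-osuc⇒≤ₒ x (β [ v ]) βv<α)
        (<ₒ-trans x (osuc x) β (<ₒ-osuc x) α<β)
descent-reach {β} {α} {v = v} nβ lβ nα βv<α α<β (desc-limit {X} lα 1≤X) =
  reach nβ lβ v (fs-NF α nα X)
        (≤ₒ-trans (β [ v ]) (α [ 1 ]) (α [ X ])
           (bachmann β nβ lβ v α nα lα βv<α α<β) (fs-mono α nα 1 X 1≤X))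
        (<ₒ-trans (α [ X ]) α β (fs-< α nα (proj₁ lα) X) α<β)

-- Unfolding, A_β(k,y) iterates A at δ = β_{k,k,c'} with
-- c' = A_β(k,y-1) ≤ c, and A_α(k,y) iterates A at a Descent α' of α.  Now
-- α' reaches β[v] (descent-reach), which reaches δ (FS-reach), so the
-- iterated functions compare pointwise; the starting values compare by
-- induction on y.
limit-domination : ∀ {k β α v b c} → NF β → Limit β → NF α →
  (β [ v ]) <ₒ α → α <ₒ β →
  AckPred β (suc k) b c → FS β (suc k) (suc k) c (β [ v ]) →
  ∀ {y u w} → y ≤ b → Ack β (suc k) y u → Ack α (suc k) y w → u ≤ w
limit-domination {k} {β} {α} {v} {b} {c} nβ lβ nα βv<α α<β pc fsv = dominate
  where
  α≢oz : α ≢ oz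
  α≢oz refl = ≮oz (β [ v ]) βv<α

  mutual
    dominate : ∀ {y u w} → y ≤ b → Ack β (suc k) y u → Ack α (suc k) y w → u ≤ w
    dominate y≤b dβ dα =
      let (cβ , δ , pcβ , fsβ , itβ) = Ack-unfold-limit lβ dβ
          (cα , α' , pcα , desc , itα) = Ack-unfold α≢oz dα
          nα' = proj₁ (descent-⊏ nα desc)
          α'⇝δ = descent-reach nβ lβ nα βv<α α<β desc
                   ◅◅ FS-reach nβ lβ (AckPred-mono y≤b pcβ pc) fsβ fsv
      in Iter-dominated (Ack-reach-mono nα' α'⇝δ) (Ack-total nα' (suc k))
                        itβ itα (dominate-pred y≤b pcβ pcα)

    dominate-pred : ∀ {y cβ cα} → y ≤ b →
      AckPred β (suc k) y cβ → AckPred α (suc k) y cα → cβ ≤ cα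
    dominate-pred {zero} _ refl refl = z≤n
    dominate-pred {suc y} y≤b dβ dα = dominate (ℕₚ.≤-trans (ℕₚ.n≤1+n y) y≤b) dβ dα

mainTheorem9 : (k b : ℕ) (α : Ord) → 3 ≤ k → NF α →
    (∀ δ → NF δ → α <ₒ δ → ∀ u v → Ack δ k b u → Ack α k b v → ¬ (u ≤ v)) →
    (lam : Ctx) (γ : Ord) (r : ℕ) → NF γ → α ≡ lam ⟦ rep γ r ⟧ →
    ∃[ c ] ∃[ δ ] ∃[ v ]
      (AckPred (nf ((lam *) ⟦ ω^ (osuc γ) + oz ⟧)) k b c
       × FS (nf ((lam *) ⟦ ω^ (osuc γ) + oz ⟧)) (k ∸ 1) k c δ
       × Ack δ k c v
       × r ≤ v)
mainTheorem9 (suc k) b _ _ nα no-overtake lam γ r nγ refl =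
  c , δ , v , pc , fs , dv , ℕₚ.≮⇒≥ v≮r
  where
  β = nf ((lam *) ⟦ ω^ (osuc γ) + oz ⟧)
  nβ = NF-nf ((lam *) ⟦ ω^ (osuc γ) + oz ⟧)
  c = proj₁ (AckPred-total nβ (suc k) b)
  pc = proj₂ (AckPred-total nβ (suc k) b)
  δ = proj₁ (FS-total nβ k (suc k) c)
  fs = proj₂ (FS-total nβ k (suc k) c)
  v = proj₁ (Ack-total (FS-NF nβ fs) (suc k) c)
  dv = proj₂ (Ack-total (FS-NF nβ fs) (suc k) c)

  v≮r : ¬ (v < r)
  v≮r v<r =
    let bracket _ lβ α<β βv<α = context-bracket lam nγ nα v<r
        (u , dβ) = Ack-total nβ (suc k) b
        (w , dα) = Ack-total nα (suc k) b
    in no-overtake β nβ α<β u w dβ dα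
         (limit-domination nβ lβ nα βv<α α<β pc (fs-suc fs dv) ℕₚ.≤-refl dβ dα)
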